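{- For integers $p',q',r'$ let $\min(p',q',r';|E|)$ denote the minimum of $|E(G)|$ over all connected finite simple graphs $G$ with $\mathrm{ind\text{ - }match}(G)=p'$, $\mathrm{min\text{ - }match}(G)=q'$ and $\mathrm{match}(G)=r'$. Let $p,q,r$ be integers with $2\le p\le q\le r\le 2q$. Then (1) $\min(p,q,r;|E|)\ge 2r-1$ if $2\le p\le q<r\le 2q$; and (2) $\min(p,r,r;|E|)\ge 2r$ if $2\le p\le q=r$.
   Context: A matching is a set of pairwise disjoint edges; a maximal matching is one not properly contained in another matching; an induced matching is a matching $M$ such that for distinct $e,f\in M$ there is no edge meeting both $e$ and $f$. $\mathrm{match}$, $\mathrm{min\text{ - }match}$, $\mathrm{ind\text{ - }match}$ are the maximum size of a matching, the minimum size of a maximal matching, and the maximum size of an induced matching. For every $1\le p\le q\le r\le 2q$ such a connected graph exists. -}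

module Defs where

open import Data.Nat using (ℕ; _≤_; _<_)
open import Data.Fin as Fin using (Fin)
open import Data.Product using (_×_; _,_; ∃; ∃-syntax; proj₁; proj₂)
open import Data.Sum using (_⊎_)
open import Data.List using (List; length)
open import Data.List.Membership.Propositional using (_∈_)
open import Data.List.Relation.Unary.All using (All)
open import Data.List.Relation.Unary.AllPairs using (AllPairs)
open import Data.List.Relation.Unary.Unique.Propositional using (Unique)
open import Data.List.Relation.Binary.Subset.Propositional using (_⊆_)
open import Relation.Binary.PropositionalEquality using (_≡_; _≢_)
open import Relation.Nullary using (¬_)

-- An edge on vertex set Fin n, stored as an ordered pair (u , v) with u < v.
Edge : ℕ → Set
Edge n = Fin n × Fin n

-- A finite simple graph: vertex set Fin n, a duplicate-free list of edges,
-- each edge (u , v) with u < v (so no loops, no multi-edges).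
record Graph : Set where
  field
    n       : ℕ
    edges   : List (Edge n)
    ordered : All (λ e → proj₁ e Fin.< proj₂ e) edges
    unique  : Unique edges
open Graph public

numEdges : Graph → ℕ
numEdges G = length (edges G)

Adj : (G : Graph) → Fin (n G) → Fin (n G) → Set
Adj G u v = (u , v) ∈ edges G ⊎ (v , u) ∈ edges G

Incident : ∀ {m} → Fin m → Edge m → Set
Incident x e = x ≡ proj₁ e ⊎ x ≡ proj₂ e

Meets : ∀ {m} → Edge m → Edge m → Set
Meets e f = ∃[ x ] (Incident x e × Incident x f)

Disjoint : ∀ {m} → Edge m → Edge m → Set
Disjoint e f = ¬ Meets e f

data Walk (G : Graph) : Fin (n G) → Fin (n G) → Set where
  here : ∀ {u} → Walk G u u
  step : ∀ {u v w} → Adj G u v → Walk G v w → Walk G u w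

Connected : Graph → Set
Connected G = (1 ≤ n G) × (∀ u v → Walk G u v)

-- A matching: a set (duplicate-free list) of pairwise disjoint edges of G.
-- (Pairwise disjointness implies the list has no duplicates.)
IsMatching : (G : Graph) → List (Edge (n G)) → Set
IsMatching G M = (M ⊆ edges G) × AllPairs Disjoint M

IsMaximalMatching : (G : Graph) → List (Edge (n G)) → Set
IsMaximalMatching G M =
  IsMatching G M × (∀ M' → IsMatching G M' → M ⊆ M' → M' ⊆ M)

IsInducedMatching : (G : Graph) → List (Edge (n G)) → Set
IsInducedMatching G M =
  (M ⊆ edges G) ×
  AllPairs (λ e f → Disjoint e f × (∀ g → g ∈ edges G → ¬ (Meets g e × Meets g f))) M

IsMaxSize : ∀ {A : Set} → (List A → Set) → ℕ → Set
IsMaxSize P k = (∃[ M ] (P M × length M ≡ k)) × (∀ M → P M → length M ≤ k)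

IsMinSize : ∀ {A : Set} → (List A → Set) → ℕ → Set
IsMinSize P k = (∃[ M ] (P M × length M ≡ k)) × (∀ M → P M → k ≤ length M)

MatchNum : Graph → ℕ → Set
MatchNum G k = IsMaxSize (IsMatching G) k

MinMatchNum : Graph → ℕ → Set
MinMatchNum G k = IsMinSize (IsMaximalMatching G) k

IndMatchNum : Graph → ℕ → Set
IndMatchNum G k = IsMaxSize (IsInducedMatching G) k

{-# OPTIONS --safe #-}
-- A matching with r edges covers 2r vertices, and a connected graph has at
-- least |V| - 1 edges; this gives (1).  For (2), suppose |E| < 2r.  Then
-- |E| < |V| ≤ |E| + 1 ≤ 2r, so by the handshake lemma some vertex x has degree
-- at most 1.  As G is connected with at least four vertices, x is a leaf at a
-- vertex y which has a further neighbour z.  A maximal matching grown greedily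
-- from the edge yz cannot cover x, so it has at most (|V| - 1)/2 < r edges,
-- contradicting min-match(G) = r.

module Submission where

open import Defs
open import Data.Nat using (ℕ; _≤_; _<_; _*_; _∸_)
open import Data.Product using (_×_)
open import Relation.Binary.PropositionalEquality using (_≡_)

open import Data.Bool using (if_then_else_)
open import Data.Empty using (⊥-elim)
open import Data.Fin using (Fin; zero; suc; _≟_; fromℕ<)
open import Data.Fin.Properties using (¬∀⟶∃¬; <⇒≢)
open import Data.List using (List; []; _∷_; length)
open import Data.List.Membership.Propositional using (_∈_; _∉_; find)
open import Data.List.Relation.Binary.Subset.Propositional using (_⊆_)
open import Data.List.Relation.Unary.All as All using (All; []; _∷_)
open import Data.List.Relation.Unary.All.Properties using (All¬⇒¬Any; ¬Any⇒All¬)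
open import Data.List.Relation.Unary.AllPairs using (AllPairs; []; _∷_)
open import Data.List.Relation.Unary.Any using (here; there; any?)
open import Data.List.Relation.Unary.Unique.Propositional using (Unique)
open import Data.Nat using (zero; suc; _+_; z≤n; s≤s; _≤?_)
open import Data.Nat.Properties
  using (+-0-monoid; +-commutativeSemigroup; +-mono-≤; +-monoˡ-≤; +-assoc; +-identityʳ;
         *-suc; *-comm; *-cancelˡ-≤; *-zeroʳ; *-identityʳ; *-monoʳ-≤;
         ≤-trans; ≤-reflexive; ≤-pred; m≤n+m; m≤m+n; <⇒≱; ≰⇒>; <-irrefl; ∸-monoˡ-≤;
         module ≤-Reasoning)
open import Data.Product using (_,_; ∃; ∃₂; proj₁; proj₂)
open import Algebra.Properties.CommutativeSemigroup +-commutativeSemigroup using (interchange)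
open import Algebra.Properties.Monoid.Sum +-0-monoid using (sum; sum-syntax; sum-cong-≗)
open import Data.Product.Properties using (≡-dec)
open import Data.Sum using (_⊎_; inj₁; inj₂; [_,_])
open import Function using (_∘_)
open import Relation.Binary.PropositionalEquality
  using (_≢_; refl; sym; trans; cong; cong₂; subst; subst₂; module ≡-Reasoning)
open import Relation.Nullary using (¬_; Dec; does; yes; no)
open import Relation.Nullary.Decidable using (dec-true; dec-false; map′; _⊎-dec_)
open import Relation.Unary using (Pred; Decidable)

sum-mono-≤ : ∀ {n} {f g : Fin n → ℕ} → (∀ i → f i ≤ g i) → sum f ≤ sum g
sum-mono-≤ {zero}  f≤g = z≤n
sum-mono-≤ {suc n} f≤g = +-mono-≤ (f≤g zero) (sum-mono-≤ (f≤g ∘ suc))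

sum-+ : ∀ {n} (f g : Fin n → ℕ) → ∑[ i < n ] (f i + g i) ≡ sum f + sum g
sum-+ {zero}  f g = refl
sum-+ {suc n} f g = begin
  (f zero + g zero) + ∑[ i < n ] (f (suc i) + g (suc i))
    ≡⟨ cong (f zero + g zero +_) (sum-+ (f ∘ suc) (g ∘ suc)) ⟩
  (f zero + g zero) + (sum (f ∘ suc) + sum (g ∘ suc))
    ≡⟨ interchange (f zero) (g zero) _ _ ⟩
  sum f + sum g ∎
  where open ≡-Reasoning

sum-const : ∀ n k → ∑[ i < n ] k ≡ n * k
sum-const zero    k = refl
sum-const (suc n) k = cong (k +_) (sum-const n k)

δ : ∀ {n} → Fin n → Fin n → ℕ
δ x a = if does (x ≟ a) then 1 else 0

δ-≡ : ∀ {n} {x a : Fin n} → x ≡ a → δ x a ≡ 1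
δ-≡ {x = x} {a} x≡a = cong (if_then 1 else 0) (dec-true (x ≟ a) x≡a)

δ-≢ : ∀ {n} {x a : Fin n} → x ≢ a → δ x a ≡ 0
δ-≢ {x = x} {a} x≢a = cong (if_then 1 else 0) (dec-false (x ≟ a) x≢a)

sum-δ : ∀ {n} (a : Fin n) → ∑[ x < n ] δ x a ≡ 1
sum-δ {suc n} zero    = cong suc (trans (sum-const n 0) (*-zeroʳ n))
sum-δ {suc n} (suc a) = sum-δ a

count : ∀ {n} → Fin n → List (Fin n) → ℕ
count x []       = 0
count x (a ∷ xs) = δ x a + count x xs

sum-count : ∀ {n} (xs : List (Fin n)) → ∑[ x < n ] count x xs ≡ length xs
sum-count {n} []       = trans (sum-const n 0) (*-zeroʳ n)
sum-count {n} (a ∷ xs) = begin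
  ∑[ x < n ] (δ x a + count x xs)             ≡⟨ sum-+ (λ x → δ x a) (λ x → count x xs) ⟩
  sum (λ x → δ x a) + sum (λ x → count x xs)  ≡⟨ cong₂ _+_ (sum-δ a) (sum-count xs) ⟩
  suc (length xs)                             ∎
  where open ≡-Reasoning

count-lower-bound : ∀ {n k} (xs : List (Fin n)) → (∀ x → k ≤ count x xs) → n * k ≤ length xs
count-lower-bound {n} {k} xs k≤count =
  subst₂ _≤_ (sum-const n k) (sum-count xs) (sum-mono-≤ k≤count)

count-upper-bound : ∀ {n k} (xs : List (Fin n)) → (∀ x → count x xs ≤ k) → length xs ≤ n * k
count-upper-bound {n} {k} xs count≤k =
  subst₂ _≤_ (sum-count xs) (sum-const n k) (sum-mono-≤ count≤k)

∈⇒count≥1 : ∀ {n} {x : Fin n} {xs} → x ∈ xs → 1 ≤ count x xs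
∈⇒count≥1 {x = x} {a ∷ xs} (here x≡a)  = subst (λ d → 1 ≤ d + count x xs) (sym (δ-≡ x≡a)) (s≤s z≤n)
∈⇒count≥1 {x = x} {a ∷ xs} (there x∈xs) = ≤-trans (∈⇒count≥1 x∈xs) (m≤n+m _ (δ x a))

∉⇒count≡0 : ∀ {n} {x : Fin n} {xs} → x ∉ xs → count x xs ≡ 0
∉⇒count≡0 {xs = []}     x∉xs = refl
∉⇒count≡0 {xs = a ∷ xs} x∉xs = cong₂ _+_ (δ-≢ (x∉xs ∘ here)) (∉⇒count≡0 (x∉xs ∘ there))

Unique⇒count≤1 : ∀ {n} {xs : List (Fin n)} → Unique xs → ∀ x → count x xs ≤ 1
Unique⇒count≤1 []                         x = z≤n
Unique⇒count≤1 {xs = a ∷ xs} (a∉xs ∷ !xs) x with x ≟ a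
... | yes refl = ≤-reflexive (cong suc (∉⇒count≡0 (All¬⇒¬Any a∉xs)))
... | no  _    = Unique⇒count≤1 !xs x

Unique⇒length≤ : ∀ {n} {xs : List (Fin n)} → Unique xs → length xs ≤ n
Unique⇒length≤ {n} {xs} !xs =
  subst (length xs ≤_) (*-identityʳ n) (count-upper-bound xs (Unique⇒count≤1 !xs))

∃-∉ : ∀ {n} (xs : List (Fin n)) → length xs < n → ∃ λ t → t ∉ xs
∃-∉ {n} xs |xs|<n = ¬∀⟶∃¬ n (_∈ xs) (λ t → any? (t ≟_) xs) (<⇒≱ |xs|<n ∘ covered⇒n≤)
  where
  covered⇒n≤ : (∀ t → t ∈ xs) → n ≤ length xs
  covered⇒n≤ t∈xs =
    subst (_≤ length xs) (*-identityʳ n) (count-lower-bound xs (∈⇒count≥1 ∘ t∈xs))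

ends : ∀ {m} → List (Edge m) → List (Fin m)
ends []            = []
ends ((u , v) ∷ L) = u ∷ v ∷ ends L

length-ends : ∀ {m} (L : List (Edge m)) → length (ends L) ≡ 2 * length L
length-ends []      = refl
length-ends (e ∷ L) = trans (cong (2 +_) (length-ends L)) (sym (*-suc 2 (length L)))

∈-ends⁺ : ∀ {m} {x : Fin m} {e L} → e ∈ L → Incident x e → x ∈ ends L
∈-ends⁺ (here refl) (inj₁ x≡u) = here x≡u
∈-ends⁺ (here refl) (inj₂ x≡v) = there (here x≡v)
∈-ends⁺ (there e∈L) x∈e        = there (there (∈-ends⁺ e∈L x∈e))

∈-ends⁻ : ∀ {m} {x : Fin m} L → x ∈ ends L → ∃ λ e → e ∈ L × Incident x e
∈-ends⁻ (e ∷ L) (here x≡u)                = e , here refl , inj₁ x≡u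
∈-ends⁻ (e ∷ L) (there (here x≡v))        = e , here refl , inj₂ x≡v
∈-ends⁻ (e ∷ L) (there (there x∈ends)) with ∈-ends⁻ L x∈ends
... | f , f∈L , x∈f = f , there f∈L , x∈f

ends-Unique : ∀ {m} {M : List (Edge m)} →
  All (λ e → proj₁ e ≢ proj₂ e) M → AllPairs Disjoint M → Unique (ends M)
ends-Unique {M = []}          []                 []                 = []
ends-Unique {M = (u , v) ∷ M} (u≢v ∷ loopless) (disjoint ∷ pairwise) =
  (u≢v ∷ ¬Any⇒All¬ _ (uncovered (inj₁ refl))) ∷ ¬Any⇒All¬ _ (uncovered (inj₂ refl))
    ∷ ends-Unique loopless pairwise
  where
  uncovered : ∀ {w} → Incident w (u , v) → w ∉ ends M
  uncovered w∈e w∈ends with ∈-ends⁻ M w∈ends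
  ... | f , f∈M , w∈f = All.lookup disjoint f∈M (_ , w∈e , w∈f)

edge-loopless : (G : Graph) {e : Edge (n G)} → e ∈ edges G → proj₁ e ≢ proj₂ e
edge-loopless G e∈E = <⇒≢ (All.lookup (ordered G) e∈E)

matching-ends-Unique : (G : Graph) {M : List (Edge (n G))} → IsMatching G M → Unique (ends M)
matching-ends-Unique G (M⊆E , pairwise) =
  ends-Unique (All.tabulate (edge-loopless G ∘ M⊆E)) pairwise

matching-size : (G : Graph) {M : List (Edge (n G))} → IsMatching G M → 2 * length M ≤ n G
matching-size G {M} isM =
  subst (_≤ n G) (length-ends M) (Unique⇒length≤ (matching-ends-Unique G isM))

degree : (G : Graph) → Fin (n G) → ℕ
degree G x = count x (ends (edges G))

degree≥2⇒n≤E : (G : Graph) → (∀ x → 2 ≤ degree G x) → n G ≤ numEdges G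
degree≥2⇒n≤E G deg≥2 = *-cancelˡ-≤ 2 (begin
  2 * n G                  ≡⟨ *-comm 2 (n G) ⟩
  n G * 2                  ≤⟨ count-lower-bound (ends (edges G)) deg≥2 ⟩
  length (ends (edges G))  ≡⟨ length-ends (edges G) ⟩
  2 * numEdges G           ∎)
  where open ≤-Reasoning

few-edges⇒degree≤1 : (G : Graph) → numEdges G < n G → ∃ λ x → degree G x ≤ 1
few-edges⇒degree≤1 G E<n
  with ¬∀⟶∃¬ (n G) (λ x → 2 ≤ degree G x) (λ x → 2 ≤? degree G x) (<⇒≱ E<n ∘ degree≥2⇒n≤E G)
... | x , deg≱2 = x , ≤-pred (≰⇒> deg≱2)

incident⇒δ+δ≥1 : ∀ {m} {x : Fin m} e → Incident x e → 1 ≤ δ x (proj₁ e) + δ x (proj₂ e)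
incident⇒δ+δ≥1 e (inj₁ x≡u) = ≤-trans (≤-reflexive (sym (δ-≡ x≡u))) (m≤m+n _ _)
incident⇒δ+δ≥1 e (inj₂ x≡v) = ≤-trans (≤-reflexive (sym (δ-≡ x≡v))) (m≤n+m _ _)

two-incident⇒count≥2 : ∀ {m} {x : Fin m} {L g h} → g ∈ L → h ∈ L → g ≢ h →
  Incident x g → Incident x h → 2 ≤ count x (ends L)
two-incident⇒count≥2 (here refl) (here refl) g≢h _ _ = ⊥-elim (g≢h refl)
two-incident⇒count≥2 {x = x} {g ∷ L} (here refl) (there h∈L) _ x∈g x∈h =
  ≤-trans (+-mono-≤ (incident⇒δ+δ≥1 g x∈g) (∈⇒count≥1 (∈-ends⁺ h∈L x∈h)))
    (≤-reflexive (+-assoc (δ x (proj₁ g)) (δ x (proj₂ g)) (count x (ends L))))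
two-incident⇒count≥2 (there g∈L) (here refl) g≢h x∈g x∈h =
  two-incident⇒count≥2 (here refl) (there g∈L) (g≢h ∘ sym) x∈h x∈g
two-incident⇒count≥2 {x = x} {e ∷ L} (there g∈L) (there h∈L) g≢h x∈g x∈h =
  ≤-trans (two-incident⇒count≥2 g∈L h∈L g≢h x∈g x∈h)
    (≤-trans (m≤n+m _ _) (m≤n+m _ (δ x (proj₁ e))))

degree≤1⇒incident-unique : (G : Graph) {x : Fin (n G)} → degree G x ≤ 1 →
  ∀ {g h} → g ∈ edges G → h ∈ edges G → Incident x g → Incident x h → g ≡ h
degree≤1⇒incident-unique G deg≤1 {g} {h} g∈E h∈E x∈g x∈h with ≡-dec _≟_ _≟_ g h
... | yes g≡h = g≡h
... | no  g≢h = ⊥-elim (<⇒≱ (two-incident⇒count≥2 g∈E h∈E g≢h x∈g x∈h) deg≤1)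

walk-crosses : ∀ {G : Graph} {ℓ} {P : Pred (Fin (n G)) ℓ} → Decidable P → ∀ {a t} → Walk G a t →
  P a → ¬ P t → ∃₂ λ u v → P u × ¬ P v × Adj G u v
walk-crosses P? here                      Pa ¬Pt = ⊥-elim (¬Pt Pa)
walk-crosses P? (step {v = v} a~v v⇝t) Pa ¬Pt with P? v
... | yes Pv = walk-crosses P? v⇝t Pv ¬Pt
... | no ¬Pv = _ , v , Pa , ¬Pv , a~v

edgeOf : (G : Graph) {u v : Fin (n G)} → Adj G u v → Edge (n G)
edgeOf G {u} {v} (inj₁ _) = u , v
edgeOf G {u} {v} (inj₂ _) = v , u

edgeOf-∈ : (G : Graph) {u v : Fin (n G)} (u~v : Adj G u v) → edgeOf G u~v ∈ edges G
edgeOf-∈ G (inj₁ uv∈E) = uv∈E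
edgeOf-∈ G (inj₂ vu∈E) = vu∈E

edgeOf-incidentˡ : (G : Graph) {u v : Fin (n G)} (u~v : Adj G u v) → Incident u (edgeOf G u~v)
edgeOf-incidentˡ G (inj₁ _) = inj₁ refl
edgeOf-incidentˡ G (inj₂ _) = inj₂ refl

edgeOf-incidentʳ : (G : Graph) {u v : Fin (n G)} (u~v : Adj G u v) → Incident v (edgeOf G u~v)
edgeOf-incidentʳ G (inj₁ _) = inj₂ refl
edgeOf-incidentʳ G (inj₂ _) = inj₁ refl

incident-edgeOf : (G : Graph) {u v w : Fin (n G)} (u~v : Adj G u v) →
  Incident w (edgeOf G u~v) → w ≡ u ⊎ w ≡ v
incident-edgeOf G (inj₁ _) w∈e = w∈e
incident-edgeOf G (inj₂ _) (inj₁ w≡v) = inj₂ w≡v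
incident-edgeOf G (inj₂ _) (inj₂ w≡u) = inj₁ w≡u

meets-sym : ∀ {m} {e f : Edge m} → Meets e f → Meets f e
meets-sym (w , w∈e , w∈f) = w , w∈f , w∈e

incident? : ∀ {m} (x : Fin m) (e : Edge m) → Dec (Incident x e)
incident? x (u , v) = x ≟ u ⊎-dec x ≟ v

meets? : ∀ {m} (e f : Edge m) → Dec (Meets e f)
meets? (u , v) f = map′ meet split (incident? u f ⊎-dec incident? v f)
  where
  meet : Incident u f ⊎ Incident v f → Meets (u , v) f
  meet (inj₁ u∈f) = u , inj₁ refl , u∈f
  meet (inj₂ v∈f) = v , inj₂ refl , v∈f
  split : Meets (u , v) f → Incident u f ⊎ Incident v f
  split (_ , inj₁ refl , u∈f) = inj₁ u∈f
  split (_ , inj₂ refl , v∈f) = inj₂ v∈f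

pairwise⇒disjoint : ∀ {m} {M : List (Edge m)} → AllPairs Disjoint M →
  ∀ {g h} → g ∈ M → h ∈ M → g ≢ h → Disjoint g h
pairwise⇒disjoint (_ ∷ _)       (here refl)  (here refl)  g≢h = ⊥-elim (g≢h refl)
pairwise⇒disjoint (g∤M ∷ _)     (here refl)  (there h∈M) _   = All.lookup g∤M h∈M
pairwise⇒disjoint (h∤M ∷ _)     (there g∈M) (here refl)  _   = All.lookup h∤M g∈M ∘ meets-sym
pairwise⇒disjoint (_ ∷ pairwise) (there g∈M) (there h∈M) g≢h =
  pairwise⇒disjoint pairwise g∈M h∈M g≢h

greedy : ∀ {m} → List (Edge m) → List (Edge m) → List (Edge m)
greedy M []      = M
greedy M (g ∷ L) with any? (meets? g) M
... | yes _ = greedy M L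
... | no  _ = greedy (g ∷ M) L

greedy-⊇ : ∀ {m} (M L : List (Edge m)) → M ⊆ greedy M L
greedy-⊇ M []      e∈M = e∈M
greedy-⊇ M (g ∷ L) e∈M with any? (meets? g) M
... | yes _ = greedy-⊇ M L e∈M
... | no  _ = greedy-⊇ (g ∷ M) L (there e∈M)

greedy-⊆ : ∀ {m} {E M : List (Edge m)} L → M ⊆ E → L ⊆ E → greedy M L ⊆ E
greedy-⊆         []      M⊆E L⊆E = M⊆E
greedy-⊆ {M = M} (g ∷ L) M⊆E L⊆E with any? (meets? g) M
... | yes _ = greedy-⊆ L M⊆E (L⊆E ∘ there)
... | no  _ = greedy-⊆ L (λ { (here refl) → L⊆E (here refl) ; (there e∈M) → M⊆E e∈M }) (L⊆E ∘ there)

greedy-pairwise : ∀ {m} {M : List (Edge m)} L → AllPairs Disjoint M → AllPairs Disjoint (greedy M L)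
greedy-pairwise         []      pairwise = pairwise
greedy-pairwise {M = M} (g ∷ L) pairwise with any? (meets? g) M
... | yes _      = greedy-pairwise L pairwise
... | no  g∤M    = greedy-pairwise L (¬Any⇒All¬ M g∤M ∷ pairwise)

greedy-dominates : ∀ {m} (M L : List (Edge m)) {g} → g ∈ L → ∃ λ h → h ∈ greedy M L × Meets g h
greedy-dominates M (g ∷ L) (here refl) with any? (meets? g) M
... | yes g⋈M = let h , h∈M , g⋈h = find g⋈M in h , greedy-⊇ M L h∈M , g⋈h
... | no  _   = g , greedy-⊇ (g ∷ M) L (here refl) , proj₁ g , inj₁ refl , inj₁ refl
greedy-dominates M (f ∷ L) (there g∈L) with any? (meets? f) M
... | yes _ = greedy-dominates M L g∈L
... | no  _ = greedy-dominates (f ∷ M) L g∈L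

dominating⇒maximal : (G : Graph) {R : List (Edge (n G))} → IsMatching G R →
  (∀ {g} → g ∈ edges G → ∃ λ h → h ∈ R × Meets g h) → IsMaximalMatching G R
dominating⇒maximal G {R} isR dominates = isR , maximal
  where
  maximal : ∀ M → IsMatching G M → R ⊆ M → M ⊆ R
  maximal M (M⊆E , pairwise) R⊆M {g} g∈M with dominates (M⊆E g∈M)
  ... | h , h∈R , g⋈h with ≡-dec _≟_ _≟_ g h
  ...   | yes refl = h∈R
  ...   | no  g≢h  = ⊥-elim (pairwise⇒disjoint pairwise g∈M (R⊆M h∈R) g≢h g⋈h)

extend-to-maximal : (G : Graph) {M : List (Edge (n G))} → IsMatching G M →
  ∃ λ R → M ⊆ R × IsMaximalMatching G R
extend-to-maximal G {M} (M⊆E , pairwise) =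
  greedy M (edges G) , greedy-⊇ M (edges G) ,
  dominating⇒maximal G (greedy-⊆ (edges G) M⊆E (λ e∈E → e∈E) , greedy-pairwise (edges G) pairwise)
    (greedy-dominates M (edges G))

merge : ∀ {m} → Fin m → Fin m → Fin m → Fin m
merge a b c = if does (c ≟ b) then a else c

merge-≢ : ∀ {m} (a b : Fin m) {c} → c ≢ b → merge a b c ≡ c
merge-≢ a b {c} c≢b = cong (if_then a else c) (dec-false (c ≟ b) c≢b)

merge-a≡merge-b : ∀ {m} (a b : Fin m) → merge a b a ≡ merge a b b
merge-a≡merge-b a b with a ≟ b | b ≟ b
... | yes _ | yes _  = refl
... | no  _ | yes _  = refl
... | _     | no b≢b = ⊥-elim (b≢b refl)

-- A union–find labelling: each edge relabels the class of its second endpoint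
-- by the label of its first, so the fixed points of label L represent the
-- classes, and adding an edge destroys at most one of them.
label : ∀ {m} → List (Edge m) → Fin m → Fin m
label []            x = x
label ((u , v) ∷ L) x = merge (label L u) (label L v) (label L x)

label-edge : ∀ {m} {L : List (Edge m)} {u v} → (u , v) ∈ L → label L u ≡ label L v
label-edge {L = (u , v) ∷ L} (here refl)   = merge-a≡merge-b (label L u) (label L v)
label-edge {L = (u' , v') ∷ L} (there uv∈L) =
  cong (merge (label L u') (label L v')) (label-edge uv∈L)

label-walk : ∀ {G : Graph} {u w} → Walk G u w → label (edges G) u ≡ label (edges G) w
label-walk here                   = refl
label-walk (step (inj₁ uv∈E) v⇝w) = trans (label-edge uv∈E) (label-walk v⇝w)
label-walk (step (inj₂ vu∈E) v⇝w) = trans (sym (label-edge vu∈E)) (label-walk v⇝w)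

representatives : ∀ {m} → List (Edge m) → ℕ
representatives {m} L = ∑[ x < m ] δ (label L x) x

representatives-[] : ∀ m → representatives {m} [] ≡ m
representatives-[] m =
  trans (sum-cong-≗ {m} (λ x → δ-≡ {x = x} refl)) (trans (sum-const m 1) (*-identityʳ m))

representatives-∷ : ∀ {m} (u v : Fin m) L → representatives L ≤ representatives ((u , v) ∷ L) + 1
representatives-∷ {m} u v L = begin
  ∑[ x < m ] δ (label L x) x                        ≤⟨ sum-mono-≤ pointwise ⟩
  ∑[ x < m ] (δ (label ((u , v) ∷ L) x) x + δ x b)  ≡⟨ sum-+ _ (λ x → δ x b) ⟩
  representatives′ + ∑[ x < m ] δ x b               ≡⟨ cong (representatives′ +_) (sum-δ b) ⟩
  representatives′ + 1                              ∎
  where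
  open ≤-Reasoning
  representatives′ : ℕ
  representatives′ = representatives ((u , v) ∷ L)
  a b : Fin m
  a = label L u
  b = label L v
  pointwise : ∀ x → δ (label L x) x ≤ δ (merge a b (label L x)) x + δ x b
  pointwise x with label L x ≟ x
  ... | no  _    = z≤n
  ... | yes ℓx≡x with x ≟ b
  ...   | yes _   = m≤n+m 1 _
  ...   | no  x≢b = ≤-reflexive (sym (trans (+-identityʳ _)
                      (δ-≡ (trans (cong (merge a b) ℓx≡x) (merge-≢ a b x≢b)))))

n≤representatives+length : ∀ {m} (L : List (Edge m)) → m ≤ representatives L + length L
n≤representatives+length {m} []            =
  ≤-reflexive (sym (trans (+-identityʳ _) (representatives-[] m)))
n≤representatives+length     ((u , v) ∷ L) = ≤-trans (n≤representatives+length L)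
  (≤-trans (+-monoˡ-≤ (length L) (representatives-∷ u v L)) (≤-reflexive (+-assoc _ 1 (length L))))

connected⇒representatives≤1 : (G : Graph) → Connected G → representatives (edges G) ≤ 1
connected⇒representatives≤1 G (1≤n , walk) = begin
  ∑[ x < n G ] δ (label (edges G) x) x  ≤⟨ sum-mono-≤ pointwise ⟩
  ∑[ x < n G ] δ x c                    ≡⟨ sum-δ c ⟩
  1                                     ∎
  where
  open ≤-Reasoning
  c : Fin (n G)
  c = label (edges G) (fromℕ< 1≤n)
  pointwise : ∀ x → δ (label (edges G) x) x ≤ δ x c
  pointwise x with label (edges G) x ≟ x
  ... | no  _    = z≤n
  ... | yes ℓx≡x = ≤-reflexive (sym (δ-≡ (trans (sym ℓx≡x) (label-walk (walk x (fromℕ< 1≤n))))))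

connected⇒n≤1+E : (G : Graph) → Connected G → n G ≤ suc (numEdges G)
connected⇒n≤1+E G connected = ≤-trans (n≤representatives+length (edges G))
  (+-monoˡ-≤ (numEdges G) (connected⇒representatives≤1 G connected))

maximal-matching-missing-leaf : (G : Graph) {x : Fin (n G)} → degree G x ≤ 1 →
  ∀ {e f} → e ∈ edges G → Incident x e → f ∈ edges G → Meets e f → ¬ Incident x f →
  ∃ λ R → IsMaximalMatching G R × suc (2 * length R) ≤ n G
maximal-matching-missing-leaf G {x} deg≤1 {e} {f} e∈E x∈e f∈E e⋈f x∉f
  with extend-to-maximal G {f ∷ []} ((λ { (here refl) → f∈E }) , [] ∷ [])
... | R , f∷[]⊆R , isMax@((R⊆E , pairwise) , _) = R , isMax , size
  where
  x∉ends : x ∉ ends R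
  x∉ends x∈ends with ∈-ends⁻ R x∈ends
  ... | g , g∈R , x∈g with degree≤1⇒incident-unique G deg≤1 e∈E (R⊆E g∈R) x∈e x∈g
  ... | refl = pairwise⇒disjoint pairwise g∈R (f∷[]⊆R (here refl)) (λ { refl → x∉f x∈e }) e⋈f
  size : suc (2 * length R) ≤ n G
  size = subst (λ k → suc k ≤ n G) (length-ends R)
    (Unique⇒length≤ (¬Any⇒All¬ _ x∉ends ∷ matching-ends-Unique G (R⊆E , pairwise)))

leaf-neighbours : (G : Graph) → Connected G → 3 ≤ n G → ∀ {x} → degree G x ≤ 1 →
  ∃₂ λ y z → x ≢ y × x ≢ z × Adj G x y × Adj G y z
leaf-neighbours G (_ , walk) 3≤n {x} deg≤1
  with ∃-∉ (x ∷ []) (≤-trans (s≤s (s≤s z≤n)) 3≤n)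
... | t , t∉x with walk-crosses (λ w → any? (w ≟_) (x ∷ [])) (walk x t) (here refl) t∉x
... | _ , y , here refl , y∉x , x~y with ∃-∉ (x ∷ y ∷ []) 3≤n
... | t′ , t′∉xy with walk-crosses (λ w → any? (w ≟_) (x ∷ y ∷ [])) (walk x t′) (here refl) t′∉xy
... | _ , z , there (here refl) , z∉xy , y~z =
  y , z , y∉x ∘ here ∘ sym , z∉xy ∘ here ∘ sym , x~y , y~z
... | _ , z , here refl         , z∉xy , x~z with incident-edgeOf G x~y (subst (Incident z)
        (degree≤1⇒incident-unique G deg≤1 (edgeOf-∈ G x~z) (edgeOf-∈ G x~y)
          (edgeOf-incidentˡ G x~z) (edgeOf-incidentˡ G x~y))
        (edgeOf-incidentʳ G x~z))
...   | inj₁ z≡x = ⊥-elim (z∉xy (here z≡x))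
...   | inj₂ z≡y = ⊥-elim (z∉xy (there (here z≡y)))

connected-leaf⇒small-maximal-matching : (G : Graph) → Connected G → 3 ≤ n G →
  ∀ {x} → degree G x ≤ 1 → ∃ λ R → IsMaximalMatching G R × suc (2 * length R) ≤ n G
connected-leaf⇒small-maximal-matching G connected 3≤n deg≤1 =
  let y , z , x≢y , x≢z , x~y , y~z = leaf-neighbours G connected 3≤n deg≤1
  in maximal-matching-missing-leaf G deg≤1 (edgeOf-∈ G x~y) (edgeOf-incidentˡ G x~y)
       (edgeOf-∈ G y~z) (y , edgeOf-incidentʳ G x~y , edgeOf-incidentˡ G y~z)
       ([ x≢y , x≢z ] ∘ incident-edgeOf G y~z)

connected-matching⇒edges : (G : Graph) → Connected G → ∀ {k} → 2 * k ≤ n G → 2 * k ∸ 1 ≤ numEdges G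
connected-matching⇒edges G connected 2k≤n = ∸-monoˡ-≤ 1 (≤-trans 2k≤n (connected⇒n≤1+E G connected))

large-maximal-matchings⇒edges : (G : Graph) → Connected G → ∀ {k} → 2 ≤ k → 2 * k ≤ n G →
  (∀ R → IsMaximalMatching G R → k ≤ length R) → 2 * k ≤ numEdges G
large-maximal-matchings⇒edges G connected {k} 2≤k 2k≤n k≤max with 2 * k ≤? numEdges G
... | yes 2k≤E = 2k≤E
... | no  2k≰E =
  let x , deg≤1        = few-edges⇒degree≤1 G (≤-trans (≰⇒> 2k≰E) 2k≤n)
      R , isMax , 2R<n = connected-leaf⇒small-maximal-matching G connected 3≤n deg≤1
  in ⊥-elim (<-irrefl refl (begin-strict
    2 * k             ≤⟨ *-monoʳ-≤ 2 (k≤max R isMax) ⟩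
    2 * length R      <⟨ 2R<n ⟩
    n G               ≤⟨ connected⇒n≤1+E G connected ⟩
    suc (numEdges G)  ≤⟨ ≰⇒> 2k≰E ⟩
    2 * k             ∎))
  where
  open ≤-Reasoning
  3≤n : 3 ≤ n G
  3≤n = ≤-trans (s≤s (s≤s (s≤s z≤n))) (≤-trans (*-monoʳ-≤ 2 2≤k) 2k≤n)

corollary2p3 : (p q r : ℕ) → 2 ≤ p → p ≤ q → q ≤ r → r ≤ 2 * q →
    (G : Graph) → Connected G →
    IndMatchNum G p → MinMatchNum G q → MatchNum G r →
    (q < r → 2 * r ∸ 1 ≤ numEdges G) × (q ≡ r → 2 * r ≤ numEdges G)
corollary2p3 p q r 2≤p p≤q q≤r _ G connected _ (_ , q≤max) ((M , isM , |M|≡r) , _) =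
  (λ _ → connected-matching⇒edges G connected {r} 2r≤n) ,
  (λ q≡r → large-maximal-matchings⇒edges G connected 2≤r 2r≤n
             (λ R isMax → subst (_≤ length R) q≡r (q≤max R isMax)))
  where
  2r≤n : 2 * r ≤ n G
  2r≤n = subst (λ k → 2 * k ≤ n G) |M|≡r (matching-size G isM)
  2≤r : 2 ≤ r
  2≤r = ≤-trans 2≤p (≤-trans p≤q q≤r)
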